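{- Assume $G$ is a graph, $f:V(G) \to \mathbb{N}$ is a mapping and $L$ is an $f$-list assignment of $G$. (1) If there is an $L$-colouring $\phi$ of $G$ such that $|\phi(V(G))| < |V(G)|$, then $L$ is $m$-extendable for any $m$. (2) Otherwise, for any $L$-colouring $\phi$ of $G$, $|\phi(V(G))| = |V(G)|$. Then $L$ is $m$-extendable if and only if $$m < |\{\phi(V(G)): \phi \text{ is an } L\text{ -colouring of } G\}|.$$
   Context: The join $G \vee \overline{K_m}$ is obtained from the disjoint union of $G$ and the edgeless graph $\overline{K_m}$ on $m$ vertices by joining every vertex of $G$ to every vertex of $\overline{K_m}$. An $f$-list assignment $L$ assigns to each $v$ a set $L(v)$ of $f(v)$ colours; an $L$-colouring is a proper colouring $\phi$ with $\phi(v)\in L(v)$. An extension of $L$ to $G \vee \overline{K_m}$ is a list assignment $L'$ with $L'(v)=L(v)$ for $v\in V(G)$ and $|L'(v)|=|V(G)|$ for each vertex $v$ of $\overline{K_m}$. $L$ is $m$-extendable if for any such extension $L'$ there exists an $L'$-colouring of $G \vee \overline{K_m}$. -}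

module Defs where

open import Data.Nat using (ℕ; zero; suc; _+_; _<_)
open import Data.Nat.Properties using (_≟_)
open import Data.Bool using (Bool; true; false)
open import Data.Fin using (Fin; splitAt; _↑ˡ_; _↑ʳ_)
open import Data.Sum using (_⊎_; inj₁; inj₂)
open import Data.List using (List; length; tabulate; deduplicate)
open import Data.List.Membership.Propositional using (_∈_)
open import Data.List.Relation.Unary.Unique.Propositional using (Unique)
open import Data.Product using (Σ; _×_; ∃; _,_)
open import Relation.Binary.PropositionalEquality using (_≡_; _≢_; refl; sym)
open import Relation.Nullary using (¬_)
open import Function.Bundles using (_⇔_)

record Graph (n : ℕ) : Set where
  field
    adj     : Fin n → Fin n → Bool
    adj-sym : ∀ u v → adj u v ≡ adj v u
    loopless : ∀ v → adj v v ≡ false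
open Graph public

-- Colours are natural numbers; a list assignment gives each vertex a
-- list of pairwise distinct colours (i.e. a finite set of colours).
ListAssignment : ℕ → Set
ListAssignment n = Fin n → List ℕ

IsFListAssignment : ∀ {n} → (Fin n → ℕ) → ListAssignment n → Set
IsFListAssignment f L = ∀ v → Unique (L v) × length (L v) ≡ f v

Proper : ∀ {n} → Graph n → (Fin n → ℕ) → Set
Proper G φ = ∀ u v → adj G u v ≡ true → φ u ≢ φ v

IsLColouring : ∀ {n} → Graph n → ListAssignment n → (Fin n → ℕ) → Set
IsLColouring G L φ = Proper G φ × (∀ v → φ v ∈ L v)

image : ∀ {n} → (Fin n → ℕ) → List ℕ
image φ = tabulate φ

∣image∣ : ∀ {n} → (Fin n → ℕ) → ℕ
∣image∣ φ = length (deduplicate _≟_ (image φ))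

SameImage : ∀ {n} → (Fin n → ℕ) → (Fin n → ℕ) → Set
SameImage φ ψ = ∀ c → (c ∈ image φ → c ∈ image ψ) × (c ∈ image ψ → c ∈ image φ)

-- The join G ∨ K̄_m on vertex set Fin (n + m): vertices i ↑ˡ m are the
-- vertices of G, vertices n ↑ʳ j are the vertices of K̄_m.
joinAdj⊎ : ∀ {n m} → Graph n → Fin n ⊎ Fin m → Fin n ⊎ Fin m → Bool
joinAdj⊎ G (inj₁ u) (inj₁ v) = adj G u v
joinAdj⊎ G (inj₁ u) (inj₂ j) = true
joinAdj⊎ G (inj₂ i) (inj₁ v) = true
joinAdj⊎ G (inj₂ i) (inj₂ j) = false

joinAdj⊎-sym : ∀ {n m} (G : Graph n) (x y : Fin n ⊎ Fin m) →
               joinAdj⊎ G x y ≡ joinAdj⊎ G y x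
joinAdj⊎-sym G (inj₁ u) (inj₁ v) = adj-sym G u v
joinAdj⊎-sym G (inj₁ u) (inj₂ j) = refl
joinAdj⊎-sym G (inj₂ i) (inj₁ v) = refl
joinAdj⊎-sym G (inj₂ i) (inj₂ j) = refl

joinAdj⊎-loop : ∀ {n m} (G : Graph n) (x : Fin n ⊎ Fin m) → joinAdj⊎ G x x ≡ false
joinAdj⊎-loop G (inj₁ u) = loopless G u
joinAdj⊎-loop G (inj₂ i) = refl

_∨K̄_ : ∀ {n} → Graph n → (m : ℕ) → Graph (n + m)
_∨K̄_ {n} G m = record
  { adj      = λ u v → joinAdj⊎ G (splitAt n u) (splitAt n v)
  ; adj-sym  = λ u v → joinAdj⊎-sym G (splitAt n u) (splitAt n v)
  ; loopless = λ v → joinAdj⊎-loop G (splitAt n v)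
  }

IsExtension : ∀ {n} (m : ℕ) → ListAssignment n → ListAssignment (n + m) → Set
IsExtension {n} m L L' =
  (∀ v → L' (v ↑ˡ m) ≡ L v) ×
  (∀ j → Unique (L' (n ↑ʳ j)) × length (L' (n ↑ʳ j)) ≡ n)

Extendable : ∀ {n} → Graph n → ListAssignment n → ℕ → Set
Extendable {n} G L m =
  ∀ (L' : ListAssignment (n + m)) → IsExtension m L L' →
  ∃ λ ψ → IsLColouring (G ∨K̄ m) L' ψ

-- m < |{φ(V(G)) : φ an L-colouring of G}|, i.e. the family of colour sets
-- of L-colourings has at least m+1 distinct members.
MoreColourSetsThan : ∀ {n} → Graph n → ListAssignment n → ℕ → Set
MoreColourSetsThan {n} G L m =
  Σ (Fin (suc m) → Fin n → ℕ) λ Φ →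
    (∀ i → IsLColouring G L (Φ i)) ×
    (∀ i j → i ≢ j → ¬ SameImage (Φ i) (Φ j))

-- A colouring ψ of G ∨ K̄_m restricts to an L-colouring φ of G, and each vertex of
-- K̄_m must take a colour of its list outside φ(V(G)); conversely such a φ extends
-- as soon as every list of K̄_m meets the complement of φ(V(G)).  A list of |V(G)|
-- colours always meets that complement when |φ(V(G))| < |V(G)|, which gives (1).
-- When all colour sets have size |V(G)|, a list misses the complement exactly when
-- it equals φ(V(G)).  Hence m-extendability fails precisely when the m lists can
-- be chosen to hit every colour set, i.e. when there are at most m colour sets:
-- one direction is the pigeonhole principle, the other takes the lists to be the
-- colour sets found so far and reads a new one off the resulting colouring.
module Submission where

open import Defs
open import Data.Nat using (ℕ; zero; suc; _<_; _≤_; _+_; s≤s; z≤n)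
open import Data.Nat.Properties using (_≟_; ≤-refl; module ≤-Reasoning; <⇒≱; m≤n⇒m≤1+n; n<1+n)
open import Data.Fin using (Fin; zero; suc; inject≤; splitAt; join; _↑ˡ_; _↑ʳ_)
open import Data.Fin.Properties using (splitAt-↑ˡ; splitAt-↑ʳ; splitAt-join; join-splitAt; any?; all?; ¬∀⟶∃¬; pigeonhole; <⇒≢)
open import Data.Sum using (inj₁; inj₂; [_,_]′)
open import Data.List using (List; _∷_; length; upTo; deduplicate)
open import Data.List.Properties using (length-removeAt′; length-upTo)
open import Data.List.Relation.Unary.Any using (here; there; _─_)
import Data.List.Relation.Unary.Any as Any
import Data.List.Relation.Unary.All as All
open import Data.List.Relation.Unary.All.Properties using (¬Any⇒All¬)
open import Data.List.Relation.Unary.AllPairs using ([]; _∷_)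
open import Data.List.Membership.Propositional using (_∈_; _∉_; find; lose)
open import Data.List.Membership.Propositional.Properties using (∈-tabulate⁺; ∈-tabulate⁻; ∈-deduplicate⁺; ∈-deduplicate⁻)
open import Data.List.Membership.DecPropositional _≟_ using (_∈?_)
open import Data.List.Relation.Binary.Subset.Propositional using (_⊆_)
open import Data.List.Relation.Unary.Unique.Propositional using (Unique)
open import Data.List.Relation.Unary.Unique.Propositional.Properties using (upTo⁺)
open import Data.List.Relation.Unary.Unique.DecPropositional.Properties _≟_ using (deduplicate-!)
open import Data.Product using (Σ; _×_; ∃; _,_; proj₁; proj₂)
open import Data.Bool using (true)
open import Function using (_∘_)
open import Function.Bundles using (_⇔_; mk⇔)
open import Relation.Binary.PropositionalEquality using (_≡_; _≢_; refl; sym; trans; cong; cong₂; subst)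
open import Relation.Nullary using (¬_; Dec; yes; no; ¬?; contradiction)
open import Relation.Nullary.Decidable using (map′; decidable-stable)

module _ {a} {A : Set a} where

  ∈-─⁺ : ∀ {x y} {xs : List A} (x∈xs : x ∈ xs) → y ∈ xs → y ≢ x → y ∈ (xs ─ x∈xs)
  ∈-─⁺ (here refl) (here refl) y≢x = contradiction refl y≢x
  ∈-─⁺ (here refl) (there y∈xs) _  = y∈xs
  ∈-─⁺ (there _)   (here y≡z)   _  = here y≡z
  ∈-─⁺ (there x∈xs) (there y∈xs) y≢x = there (∈-─⁺ x∈xs y∈xs y≢x)

  unique-⊆⇒length≤ : ∀ {xs ys : List A} → Unique xs → xs ⊆ ys → length xs ≤ length ys
  unique-⊆⇒length≤ [] _ = z≤n
  unique-⊆⇒length≤ {x ∷ xs} {ys} (x∉xs ∷ xs!) x∷xs⊆ys = begin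
    suc (length xs)          ≤⟨ s≤s (unique-⊆⇒length≤ xs! xs⊆ys─x) ⟩
    suc (length (ys ─ x∈ys)) ≡⟨ length-removeAt′ ys (Any.index x∈ys) ⟨
    length ys                ∎
    where
    open ≤-Reasoning
    x∈ys : x ∈ ys
    x∈ys = x∷xs⊆ys (here refl)
    xs⊆ys─x : xs ⊆ (ys ─ x∈ys)
    xs⊆ys─x y∈xs = ∈-─⁺ x∈ys (x∷xs⊆ys (there y∈xs)) (All.lookup x∉xs y∈xs ∘ sym)

  padRight : ∀ {k m} → k ≤ m → A → (Fin k → A) → Fin m → A
  padRight z≤n      a xs j       = a
  padRight (s≤s le) a xs zero    = xs zero
  padRight (s≤s le) a xs (suc j) = padRight le a (xs ∘ suc) j

  padRight-inject≤ : ∀ {k m} (k≤m : k ≤ m) a (xs : Fin k → A) i →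
                     padRight k≤m a xs (inject≤ i k≤m) ≡ xs i
  padRight-inject≤ (s≤s le) a xs zero    = refl
  padRight-inject≤ (s≤s le) a xs (suc i) = padRight-inject≤ le a (xs ∘ suc) i

  padRight⁺ : ∀ {p} (P : A → Set p) {k m} (k≤m : k ≤ m) {a} {xs : Fin k → A} →
              P a → (∀ i → P (xs i)) → ∀ j → P (padRight k≤m a xs j)
  padRight⁺ P z≤n      pa pxs j       = pa
  padRight⁺ P (s≤s le) pa pxs zero    = pxs zero
  padRight⁺ P (s≤s le) pa pxs (suc j) = padRight⁺ P le pa (pxs ∘ suc) j

module _ {n : ℕ} where

  colours : (Fin n → ℕ) → List ℕ
  colours φ = deduplicate _≟_ (image φ)

  ⊆image⇒length≤∣image∣ : ∀ {xs} {φ : Fin n → ℕ} → Unique xs → xs ⊆ image φ → length xs ≤ ∣image∣ φ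
  ⊆image⇒length≤∣image∣ xs! xs⊆φ = unique-⊆⇒length≤ xs! (∈-deduplicate⁺ _≟_ ∘ xs⊆φ)

  ⊆image⇒image⊆ : ∀ {xs} {φ : Fin n → ℕ} → Unique xs → length xs ≡ ∣image∣ φ →
                  xs ⊆ image φ → image φ ⊆ xs
  ⊆image⇒image⊆ {xs} xs! ∣xs∣≡ xs⊆φ {d} d∈φ = decidable-stable (d ∈? xs) λ d∉xs →
    <⇒≱ (subst (_< _) ∣xs∣≡ (n<1+n _))
        (⊆image⇒length≤∣image∣ (¬Any⇒All¬ xs d∉xs ∷ xs!) λ { (here refl) → d∈φ ; (there c∈xs) → xs⊆φ c∈xs })

  ⊆images⇒SameImage : ∀ {xs} {φ ψ : Fin n → ℕ} → Unique xs →
                      length xs ≡ ∣image∣ φ → length xs ≡ ∣image∣ ψ →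
                      xs ⊆ image φ → xs ⊆ image ψ → SameImage φ ψ
  ⊆images⇒SameImage xs! ∣xs∣≡φ ∣xs∣≡ψ xs⊆φ xs⊆ψ c =
    xs⊆ψ ∘ ⊆image⇒image⊆ xs! ∣xs∣≡φ xs⊆φ , xs⊆φ ∘ ⊆image⇒image⊆ xs! ∣xs∣≡ψ xs⊆ψ

  SameImage-sym : {φ ψ : Fin n → ℕ} → SameImage φ ψ → SameImage ψ φ
  SameImage-sym same c = proj₂ (same c) , proj₁ (same c)

  HasFreeColour : List ℕ → (Fin n → ℕ) → Set
  HasFreeColour xs φ = ∃ λ c → c ∈ xs × c ∉ image φ

  hasFreeColour? : ∀ xs (φ : Fin n → ℕ) → Dec (HasFreeColour xs φ)
  hasFreeColour? xs φ =
    map′ find (λ (_ , c∈xs , c∉φ) → lose c∈xs c∉φ) (Any.any? (λ c → ¬? (c ∈? image φ)) xs)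

  ¬hasFreeColour⇒⊆ : ∀ {xs} {φ : Fin n → ℕ} → ¬ HasFreeColour xs φ → xs ⊆ image φ
  ¬hasFreeColour⇒⊆ {φ = φ} ¬free {c} c∈xs = decidable-stable (c ∈? image φ) (λ c∉φ → ¬free (c , c∈xs , c∉φ))

  ∣image∣<length⇒hasFreeColour : ∀ {xs} {φ : Fin n → ℕ} → Unique xs → ∣image∣ φ < length xs →
                                 HasFreeColour xs φ
  ∣image∣<length⇒hasFreeColour {xs} {φ} xs! φ<xs with hasFreeColour? xs φ
  ... | yes free = free
  ... | no ¬free = contradiction (⊆image⇒length≤∣image∣ xs! (¬hasFreeColour⇒⊆ ¬free)) (<⇒≱ φ<xs)

  hasFreeColour⇒¬SameImage : {φ ψ : Fin n → ℕ} → HasFreeColour (colours ψ) φ → ¬ SameImage φ ψ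
  hasFreeColour⇒¬SameImage {ψ = ψ} (c , c∈ψ , c∉φ) same =
    c∉φ (proj₂ (same c) (∈-deduplicate⁻ _≟_ (image ψ) c∈ψ))

  ¬someFree⇒covered : ∀ {k m} {xss : Fin m → List ℕ} {Φ : Fin k → Fin n → ℕ} →
                      ¬ (∃ λ i → ∀ j → HasFreeColour (xss j) (Φ i)) →
                      ∀ i → ∃ λ j → xss j ⊆ image (Φ i)
  ¬someFree⇒covered {m = m} {xss} {Φ} ¬free i
    with j , ¬free-j ← ¬∀⟶∃¬ m _ (λ j → hasFreeColour? (xss j) (Φ i)) (λ free → ¬free (i , free)) =
    j , ¬hasFreeColour⇒⊆ ¬free-j

module _ {n m : ℕ} (G : Graph n) where

  adj-join : ∀ x y → adj (G ∨K̄ m) (join n m x) (join n m y) ≡ joinAdj⊎ G x y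
  adj-join x y = cong₂ (joinAdj⊎ G) (splitAt-join n m x) (splitAt-join n m y)

  module _ (L : ListAssignment n) (L' : ListAssignment (n + m))
           (L'-on-G : ∀ v → L' (v ↑ˡ m) ≡ L v) where

    join-colouring : ∀ {φ} → IsLColouring G L φ → (∀ j → HasFreeColour (L' (n ↑ʳ j)) φ) →
                     ∃ λ ψ → IsLColouring (G ∨K̄ m) L' ψ
    join-colouring {φ} (φ-proper , φ∈L) free =
      [ φ , χ ]′ ∘ splitAt n ,
      (λ u v → proper⊎ (splitAt n u) (splitAt n v)) ,
      (λ x → subst (λ y → [ φ , χ ]′ (splitAt n x) ∈ L' y) (join-splitAt n m x) (∈L'⊎ (splitAt n x)))
      where
      χ : Fin m → ℕ
      χ j = proj₁ (free j)
      χ≢φ : ∀ j v → χ j ≢ φ v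
      χ≢φ j v χ≡φ = proj₂ (proj₂ (free j)) (subst (_∈ image φ) (sym χ≡φ) (∈-tabulate⁺ v))
      proper⊎ : ∀ x y → joinAdj⊎ G x y ≡ true → [ φ , χ ]′ x ≢ [ φ , χ ]′ y
      proper⊎ (inj₁ u) (inj₁ v) uv = φ-proper u v uv
      proper⊎ (inj₁ u) (inj₂ j) _  = χ≢φ j u ∘ sym
      proper⊎ (inj₂ j) (inj₁ v) _  = χ≢φ j v
      proper⊎ (inj₂ i) (inj₂ j) ()
      ∈L'⊎ : ∀ x → [ φ , χ ]′ x ∈ L' (join n m x)
      ∈L'⊎ (inj₁ v) = subst (φ v ∈_) (sym (L'-on-G v)) (φ∈L v)
      ∈L'⊎ (inj₂ j) = proj₁ (proj₂ (free j))

    restrict-join-colouring : ∀ {ψ} → IsLColouring (G ∨K̄ m) L' ψ →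
                              IsLColouring G L (ψ ∘ (_↑ˡ m)) ×
                              (∀ j → HasFreeColour (L' (n ↑ʳ j)) (ψ ∘ (_↑ˡ m)))
    restrict-join-colouring {ψ} (ψ-proper , ψ∈L') = (φ-proper , φ∈L) , free
      where
      φ-proper : Proper G (ψ ∘ (_↑ˡ m))
      φ-proper u v uv = ψ-proper (u ↑ˡ m) (v ↑ˡ m) (trans (adj-join (inj₁ u) (inj₁ v)) uv)
      φ∈L : ∀ v → ψ (v ↑ˡ m) ∈ L v
      φ∈L v = subst (_ ∈_) (L'-on-G v) (ψ∈L' (v ↑ˡ m))
      free : ∀ j → HasFreeColour (L' (n ↑ʳ j)) (ψ ∘ (_↑ˡ m))
      free j = ψ (n ↑ʳ j) , ψ∈L' (n ↑ʳ j) , λ c∈φ →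
        let v , c≡φv = ∈-tabulate⁻ c∈φ
        in ψ-proper (n ↑ʳ j) (v ↑ˡ m) (adj-join (inj₂ j) (inj₁ v)) c≡φv

  joinLists : ListAssignment n → (Fin m → List ℕ) → ListAssignment (n + m)
  joinLists L xss = [ L , xss ]′ ∘ splitAt n

  joinLists-↑ʳ : ∀ L xss j → joinLists L xss (n ↑ʳ j) ≡ xss j
  joinLists-↑ʳ L xss j = cong [ L , xss ]′ (splitAt-↑ʳ n m j)

  joinLists-isExtension : ∀ L xss → (∀ j → Unique (xss j) × length (xss j) ≡ n) →
                          IsExtension m L (joinLists L xss)
  joinLists-isExtension L xss xss-ok =
    (λ v → cong [ L , xss ]′ (splitAt-↑ˡ n v m)) ,
    (λ j → subst (λ xs → Unique xs × length xs ≡ n) (sym (joinLists-↑ʳ L xss j)) (xss-ok j))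

DistinctColourSets : ∀ {n} → Graph n → ListAssignment n → ℕ → Set
DistinctColourSets {n} G L k =
  Σ (Fin k → Fin n → ℕ) λ Φ →
    (∀ i → IsLColouring G L (Φ i)) × (∀ i j → i ≢ j → ¬ SameImage (Φ i) (Φ j))

module _ {n} (G : Graph n) (L : ListAssignment n) where

  smallColourSet⇒extendable : (∃ λ φ → IsLColouring G L φ × ∣image∣ φ < n) →
                              ∀ m → Extendable G L m
  smallColourSet⇒extendable (φ , φ-col , φ-small) m L' (L'-on-G , lists) =
    join-colouring G L L' L'-on-G φ-col λ j →
      ∣image∣<length⇒hasFreeColour (proj₁ (lists j)) (subst (_ <_) (sym (proj₂ (lists j))) φ-small)

  module _ (full : ∀ φ → IsLColouring G L φ → ∣image∣ φ ≡ n) where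

    coveredColourSets⇒SameImage : ∀ {m} (xss : Fin m → List ℕ) → (∀ j → Unique (xss j) × length (xss j) ≡ n) →
                                  (Φ : Fin (suc m) → Fin n → ℕ) → (∀ i → IsLColouring G L (Φ i)) →
                                  (∀ i → ∃ λ j → xss j ⊆ image (Φ i)) →
                                  ∃ λ i₁ → ∃ λ i₂ → i₁ ≢ i₂ × SameImage (Φ i₁) (Φ i₂)
    coveredColourSets⇒SameImage {m} xss xss-ok Φ Φ-col cover
      with i₁ , i₂ , i₁<i₂ , j₁≡j₂ ← pigeonhole (n<1+n m) (proj₁ ∘ cover) =
      i₁ , i₂ , <⇒≢ i₁<i₂ ,
      ⊆images⇒SameImage (proj₁ (xss-ok j)) (∣xs∣≡ i₁) (∣xs∣≡ i₂) (proj₂ (cover i₁))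
        (subst (λ j → xss j ⊆ image (Φ i₂)) (sym j₁≡j₂) (proj₂ (cover i₂)))
      where
      j : Fin m
      j = proj₁ (cover i₁)
      ∣xs∣≡ : ∀ i → length (xss j) ≡ ∣image∣ (Φ i)
      ∣xs∣≡ i = trans (proj₂ (xss-ok j)) (sym (full (Φ i) (Φ-col i)))

    distinctColourSets⇒extendable : ∀ m → MoreColourSetsThan G L m → Extendable G L m
    distinctColourSets⇒extendable m (Φ , Φ-col , distinct) L' (L'-on-G , lists)
      with any? (λ i → all? (λ j → hasFreeColour? (L' (n ↑ʳ j)) (Φ i)))
    ... | yes (i , free) = join-colouring G L L' L'-on-G (Φ-col i) free
    ... | no ¬free
      with i₁ , i₂ , i₁≢i₂ , same ← coveredColourSets⇒SameImage _ lists Φ Φ-col (¬someFree⇒covered ¬free) =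
      contradiction same (distinct i₁ i₂ i₁≢i₂)

    newColourSet : ∀ {k m} → Extendable G L m → k ≤ m →
                   (Φ : Fin k → Fin n → ℕ) → (∀ i → IsLColouring G L (Φ i)) →
                   ∃ λ φ → IsLColouring G L φ × ∀ i → ¬ SameImage φ (Φ i)
    newColourSet {m = m} E k≤m Φ Φ-col =
      let ψ , ψ-col = E L' L'-ext
          φ-col , free = restrict-join-colouring G L L' (proj₁ L'-ext) ψ-col
      in _ , φ-col , λ i → hasFreeColour⇒¬SameImage
        (subst (λ xs → HasFreeColour xs _)
               (trans (joinLists-↑ʳ G L xss (inject≤ i k≤m)) (padRight-inject≤ k≤m (upTo n) (colours ∘ Φ) i))
               (free (inject≤ i k≤m)))
      where
      xss : Fin m → List ℕ
      xss = padRight k≤m (upTo n) (colours ∘ Φ)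
      xss-ok : ∀ j → Unique (xss j) × length (xss j) ≡ n
      xss-ok = padRight⁺ (λ xs → Unique xs × length xs ≡ n) k≤m (upTo⁺ n , length-upTo n)
                         (λ i → deduplicate-! (image (Φ i)) , full (Φ i) (Φ-col i))
      L' : ListAssignment (n + m)
      L' = joinLists G L xss
      L'-ext : IsExtension m L L'
      L'-ext = joinLists-isExtension G L xss xss-ok

    extendable⇒distinctColourSets : ∀ {m} → Extendable G L m → ∀ k → k ≤ suc m → DistinctColourSets G L k
    extendable⇒distinctColourSets E zero _ = (λ ()) , (λ ()) , (λ ())
    extendable⇒distinctColourSets E (suc k) (s≤s k≤m)
      with Φ , Φ-col , distinct ← extendable⇒distinctColourSets E k (m≤n⇒m≤1+n k≤m)
      with φ , φ-col , φ-new ← newColourSet E k≤m Φ Φ-col =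
      Φ′ , cols , distinct′
      where
      Φ′ : Fin (suc k) → Fin n → ℕ
      Φ′ zero    = φ
      Φ′ (suc i) = Φ i
      cols : ∀ i → IsLColouring G L (Φ′ i)
      cols zero    = φ-col
      cols (suc i) = Φ-col i
      distinct′ : ∀ i j → i ≢ j → ¬ SameImage (Φ′ i) (Φ′ j)
      distinct′ zero    zero    0≢0 = contradiction refl 0≢0
      distinct′ zero    (suc j) _   = φ-new j
      distinct′ (suc i) zero    _   = φ-new i ∘ SameImage-sym
      distinct′ (suc i) (suc j) i≢j = distinct i j (i≢j ∘ cong suc)

lemma20 : ∀ {n} (G : Graph n) (f : Fin n → ℕ) (L : ListAssignment n) →
          IsFListAssignment f L →
          ((∃ λ φ → IsLColouring G L φ × ∣image∣ φ < n) → ∀ m → Extendable G L m)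
          ×
          ((∀ φ → IsLColouring G L φ → ∣image∣ φ ≡ n) →
            ∀ m → (Extendable G L m ⇔ MoreColourSetsThan G L m))
lemma20 G f L _ =
  smallColourSet⇒extendable G L ,
  λ full m → mk⇔ (λ E → extendable⇒distinctColourSets G L full E (suc m) ≤-refl)
                 (distinctColourSets⇒extendable G L full m)
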